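{- Let $X$ be a finite pure $d$-dimensional weighted simplicial complex, $0\le k\le d-2$ and $f\in C^k(X)$. For a vertex $v$ let $f|_v\in C^k(X_v)$ be the restriction $f|_v(\tau)=f(\tau)$, $\tau\in X_v(k)$. Then \[ \langle M_kf,f\rangle=\sum_{v\in X(0)}w(v)\,\big\langle M^{X_v}_k f|_v,\ f|_v\big\rangle_v . \]
   Context: Weights $w>0$ with $\sum_{X(d)}w=1$ and $w(\tau)=\binom{d+1}{i+1}^{ -1}\sum_{\sigma\in X(d),\sigma\supseteq\tau}w(\sigma)$ for $\tau\in X(i)$; links $X_\sigma=\{\tau\setminus\sigma:\sigma\subseteq\tau\in X\}$ with weights $w_\sigma(\tau)=\frac{w(\tau\cup\sigma)}{\binom{i+j+2}{i+1}w(\sigma)}$, $\tau\in X_\sigma(j)$. $C^k(Y)$: functions $Y(k)\to\mathbb R$ with $\langle f,g\rangle=\sum w(\sigma)f(\sigma)g(\sigma)$ (link weights in links, written $\langle\cdot,\cdot\rangle_v$). For a complex $Y$ (namely $X$ or a link) the non-lazy walk on $C^k(Y)$ is $(M^Y_kf)(\sigma)=\frac1{k+1}\sum_{\tau\in Y(k):\sigma\cup\tau\in Y(k+1)}w_\sigma(\tau\setminus\sigma)f(\tau)$, with $w_\sigma$ the link weights computed in $Y$; $M_k=M^X_k$. -}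

module Defs where

open import Level using (Level; _⊔_) renaming (suc to lsuc)
open import Algebra.Bundles using (CommutativeRing)
open import Relation.Binary.Core using (Rel)
open import Relation.Binary.Structures using (IsStrictPartialOrder)
open import Relation.Nullary using (¬_)
open import Data.Bool using (Bool; true; false; _∧_; if_then_else_)
open import Data.Nat using (ℕ; zero; suc; _≤_; _≡ᵇ_) renaming (_+_ to _+ℕ_)
open import Data.Nat.Combinatorics using (_C_)
open import Data.Vec using (Vec; []; _∷_)
open import Data.List using (List; []; _∷_; _++_; map; foldr)
open import Data.Product using (Σ; _×_)
open import Data.Fin.Subset using (Subset; _∪_; _─_; _⊆_; ∣_∣)
open import Relation.Binary.PropositionalEquality using (_≡_)

-- Ordered fields (the paper works over ℝ; ℝ is a model of this record)

record OrderedField (c ℓ : Level) : Set (lsuc (c ⊔ ℓ)) where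
  field
    commutativeRing : CommutativeRing c ℓ
  open CommutativeRing commutativeRing public
  infix 4 _<_
  infix 8 _⁻¹
  field
    _<_                  : Rel Carrier ℓ
    <-isStrictPartialOrder : IsStrictPartialOrder _≈_ _<_
    0<1                  : 0# < 1#
    +-mono-<             : ∀ {x y} z → x < y → (x + z) < (y + z)
    *-pos                : ∀ {x y} → 0# < x → 0# < y → 0# < (x * y)
    _⁻¹                  : Carrier → Carrier
    ⁻¹-inverse           : ∀ x → ¬ (x ≈ 0#) → (x * x ⁻¹) ≈ 1#

allSubsets : (n : ℕ) → List (Subset n)
allSubsets zero    = [] ∷ []
allSubsets (suc n) = map (true ∷_) (allSubsets n) ++ map (false ∷_) (allSubsets n)

_⊆ᵇ_ : ∀ {n} → Subset n → Subset n → Bool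
[]      ⊆ᵇ []      = true
(true  ∷ p) ⊆ᵇ (false ∷ q) = false
(true  ∷ p) ⊆ᵇ (true  ∷ q) = p ⊆ᵇ q
(false ∷ p) ⊆ᵇ (_     ∷ q) = p ⊆ᵇ q

disjointᵇ : ∀ {n} → Subset n → Subset n → Bool
disjointᵇ []      []      = true
disjointᵇ (true ∷ p) (true ∷ q) = false
disjointᵇ (true ∷ p) (false ∷ q) = disjointᵇ p q
disjointᵇ (false ∷ p) (_ ∷ q) = disjointᵇ p q

-- Complexes on vertex set Fin n: a (decidable) set of faces Subset n → Bool.
-- A face σ has dimension k iff ∣ σ ∣ = k + 1.

Complex : ℕ → Set
Complex n = Subset n → Bool

inDim : ∀ {n} → Complex n → ℕ → Subset n → Bool
inDim Y k σ = Y σ ∧ (∣ σ ∣ ≡ᵇ suc k)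

IsPureComplex : ∀ {n} → Complex n → ℕ → Set
IsPureComplex {n} X d =
  (∀ (σ τ : Subset n) → τ ⊆ σ → X σ ≡ true → X τ ≡ true)
  × (∀ (σ : Subset n) → X σ ≡ true → ∣ σ ∣ ≤ suc d)
  × (∀ (σ : Subset n) → X σ ≡ true →
       Σ (Subset n) (λ τ → σ ⊆ τ × X τ ≡ true × ∣ τ ∣ ≡ suc d))

-- link X_σ = { τ ∖ σ : σ ⊆ τ ∈ X } = { ρ : ρ ∩ σ = ∅ , ρ ∪ σ ∈ X }
link : ∀ {n} → Complex n → Subset n → Complex n
link Y σ ρ = Y (ρ ∪ σ) ∧ disjointᵇ ρ σ

module _ {c ℓ : Level} (F : OrderedField c ℓ) where
  open OrderedField F

  fromℕ : ℕ → Carrier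
  fromℕ zero    = 0#
  fromℕ (suc m) = 1# + fromℕ m

  sumDim : ∀ {n} → Complex n → ℕ → (Subset n → Carrier) → Carrier
  sumDim {n} Y k g =
    foldr (λ σ acc → (if inDim Y k σ then g σ else 0#) + acc) 0# (allSubsets n)

  inducedW : ∀ {n} → Complex n → ℕ → (Subset n → Carrier) → Subset n → Carrier
  inducedW X d wtop τ =
    (fromℕ (suc d C ∣ τ ∣)) ⁻¹
      * sumDim X d (λ σ → if τ ⊆ᵇ σ then wtop σ else 0#)

  linkW : ∀ {n} → (Subset n → Carrier) → Subset n → Subset n → Carrier
  linkW wY σ ρ = wY (ρ ∪ σ) * (fromℕ ((∣ σ ∣ +ℕ ∣ ρ ∣) C ∣ σ ∣) * wY σ) ⁻¹

  inner : ∀ {n} → Complex n → (Subset n → Carrier) → ℕ →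
          (Subset n → Carrier) → (Subset n → Carrier) → Carrier
  inner Y wY k f g = sumDim Y k (λ σ → wY σ * (f σ * g σ))

  walk : ∀ {n} → Complex n → (Subset n → Carrier) → ℕ →
         (Subset n → Carrier) → Subset n → Carrier
  walk Y wY k f σ =
    (fromℕ (suc k)) ⁻¹
      * sumDim Y k (λ τ → if inDim Y (suc k) (σ ∪ τ)
                            then linkW wY σ (τ ─ σ) * f τ
                            else 0#)

-- Both sides are quadratic forms in f supported on pairs of k-faces σ, τ spanning a (k+1)-face
-- η = σ ∪ τ. Unfolding the walk and the link weights, ⟨M_k f, f⟩ is ((k+1)(k+2))⁻¹ Σ w(η) f(σ) f(τ),
-- and the v-th term on the right is the same sum over the pairs in the link X_v, with w(η) replaced
-- by w(η ∪ v)/(k+3). After exchanging the sums over v and over (σ, τ) it remains to show that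
-- Σ_v w(η ∪ v) = (k+3) w(η), the sum running over the vertices v ∉ η with η ∪ v ∈ X. Expanding the
-- induced weights, this is double counting: every facet ρ ⊇ η has d − k − 1 vertices outside η, and
-- (d − k − 1) C(d+1, k+2) = (k+3) C(d+1, k+3).

module Submission where

open import Defs
open import Level using (Level)
open import Data.Bool using (Bool; true; false; _∧_; if_then_else_; not)
open import Data.Bool.Properties using (∧-zeroʳ)
open import Data.Nat using (ℕ; zero; suc; _≤_; _∸_; _≡ᵇ_; s≤s) renaming (_+_ to _+ℕ_; _*_ to _*ℕ_)
open import Data.Nat.Combinatorics using (_C_)
open import Data.Vec using ([]; _∷_)
open import Data.List using (List; []; _∷_; _++_; map; foldr)
open import Data.List.Membership.Propositional using (_∈_)
open import Data.List.Relation.Unary.Any using (here; there)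
open import Data.List.Membership.Propositional.Properties using (∈-map⁺; ∈-++⁺ˡ; ∈-++⁺ʳ)
open import Data.Fin.Subset using (Subset; ∣_∣; _∪_; _─_; _⊆_) renaming (⊥ to ∅)
open import Data.Product using (_×_; _,_; proj₁; proj₂)
open import Data.Sum using (_⊎_; inj₁; inj₂)
open import Data.Empty using (⊥-elim)
open import Relation.Binary.Structures using (IsStrictPartialOrder)
open import Relation.Binary.PropositionalEquality as P using (_≡_; _≢_)
open import Relation.Nullary using (yes; no)
import Relation.Binary.Reasoning.Setoid as SetoidReasoning
import Algebra.Solver.CommutativeMonoid as CommutativeMonoidSolver

module FieldProperties {c ℓ : Level} (F : OrderedField c ℓ) where
  open OrderedField F
  open SetoidReasoning setoid
  open IsStrictPartialOrder <-isStrictPartialOrder using (irrefl; <-respʳ-≈) renaming (trans to <-trans)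
  open CommutativeMonoidSolver *-commutativeMonoid using (solve; _⊕_; _⊜_)

  >0⇒≉0 : ∀ {x} → 0# < x → x ≉ 0#
  >0⇒≉0 0<x x≈0 = irrefl (sym x≈0) 0<x

  ⁻¹-cancelˡ : ∀ {x} y → x ≉ 0# → x * (x ⁻¹ * y) ≈ y
  ⁻¹-cancelˡ {x} y x≉0 = begin
    x * (x ⁻¹ * y)  ≈⟨ *-assoc x (x ⁻¹) y ⟨
    x * x ⁻¹ * y    ≈⟨ *-congʳ (⁻¹-inverse x x≉0) ⟩
    1# * y          ≈⟨ *-identityˡ y ⟩
    y               ∎

  ⁻¹-cancelʳ : ∀ {x} y → x ≉ 0# → x ⁻¹ * (x * y) ≈ y
  ⁻¹-cancelʳ {x} y x≉0 = begin
    x ⁻¹ * (x * y)  ≈⟨ *-assoc (x ⁻¹) x y ⟨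
    x ⁻¹ * x * y    ≈⟨ *-congʳ (*-comm (x ⁻¹) x) ⟩
    x * x ⁻¹ * y    ≈⟨ *-assoc x (x ⁻¹) y ⟩
    x * (x ⁻¹ * y)  ≈⟨ ⁻¹-cancelˡ y x≉0 ⟩
    y               ∎

  *-≉0 : ∀ {x y} → x ≉ 0# → y ≉ 0# → x * y ≉ 0#
  *-≉0 {x} {y} x≉0 y≉0 xy≈0 = y≉0 (begin
    y               ≈⟨ ⁻¹-cancelʳ y x≉0 ⟨
    x ⁻¹ * (x * y)  ≈⟨ *-congˡ xy≈0 ⟩
    x ⁻¹ * 0#       ≈⟨ zeroʳ (x ⁻¹) ⟩
    0#              ∎)

  ⁻¹-≉0 : ∀ {x} → x ≉ 0# → x ⁻¹ ≉ 0#
  ⁻¹-≉0 {x} x≉0 x⁻¹≈0 = irrefl (begin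
    0#          ≈⟨ zeroʳ x ⟨
    x * 0#      ≈⟨ *-congˡ x⁻¹≈0 ⟨
    x * x ⁻¹    ≈⟨ ⁻¹-inverse x x≉0 ⟩
    1#          ∎) 0<1

  ⁻¹-unique : ∀ {x y} → x ≉ 0# → x * y ≈ 1# → y ≈ x ⁻¹
  ⁻¹-unique {x} {y} x≉0 xy≈1 = begin
    y               ≈⟨ ⁻¹-cancelʳ y x≉0 ⟨
    x ⁻¹ * (x * y)  ≈⟨ *-congˡ xy≈1 ⟩
    x ⁻¹ * 1#       ≈⟨ *-identityʳ (x ⁻¹) ⟩
    x ⁻¹            ∎

  ⁻¹-distrib-* : ∀ {x y} → x ≉ 0# → y ≉ 0# → (x * y) ⁻¹ ≈ x ⁻¹ * y ⁻¹
  ⁻¹-distrib-* {x} {y} x≉0 y≉0 = sym (⁻¹-unique (*-≉0 x≉0 y≉0) (begin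
    x * y * (x ⁻¹ * y ⁻¹)        ≈⟨ solve 4 (λ a b a' b' → (a ⊕ b) ⊕ (a' ⊕ b') ⊜ (a ⊕ a') ⊕ (b ⊕ b')) refl x y (x ⁻¹) (y ⁻¹) ⟩
    x * x ⁻¹ * (y * y ⁻¹)        ≈⟨ *-cong (⁻¹-inverse x x≉0) (⁻¹-inverse y y≉0) ⟩
    1# * 1#                      ≈⟨ *-identityˡ 1# ⟩
    1#                           ∎))

  fromℕ-+ : ∀ m n → fromℕ F (m +ℕ n) ≈ fromℕ F m + fromℕ F n
  fromℕ-+ zero    n = sym (+-identityˡ _)
  fromℕ-+ (suc m) n = trans (+-congˡ (fromℕ-+ m n)) (sym (+-assoc _ _ _))

  fromℕ-* : ∀ m n → fromℕ F (m *ℕ n) ≈ fromℕ F m * fromℕ F n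
  fromℕ-* zero    n = sym (zeroˡ _)
  fromℕ-* (suc m) n = begin
    fromℕ F (n +ℕ m *ℕ n)                    ≈⟨ fromℕ-+ n (m *ℕ n) ⟩
    fromℕ F n + fromℕ F (m *ℕ n)             ≈⟨ +-cong (sym (*-identityˡ _)) (fromℕ-* m n) ⟩
    1# * fromℕ F n + fromℕ F m * fromℕ F n   ≈⟨ distribʳ _ _ _ ⟨
    (1# + fromℕ F m) * fromℕ F n             ∎

  ⁻¹-*-transpose : ∀ {a b c e} → a ≉ 0# → c ≉ 0# → b * c ≈ e * a → a ⁻¹ * b ≈ e * c ⁻¹
  ⁻¹-*-transpose {a} {b} {c} {e} a≉0 c≉0 bc≈ea = begin
    a ⁻¹ * b                ≈⟨ *-identityʳ _ ⟨
    a ⁻¹ * b * 1#           ≈⟨ *-congˡ (⁻¹-inverse c c≉0) ⟨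
    a ⁻¹ * b * (c * c ⁻¹)   ≈⟨ solve 4 (λ a' b c c' → (a' ⊕ b) ⊕ (c ⊕ c') ⊜ a' ⊕ ((b ⊕ c) ⊕ c')) refl (a ⁻¹) b c (c ⁻¹) ⟩
    a ⁻¹ * (b * c * c ⁻¹)   ≈⟨ *-congˡ (*-congʳ bc≈ea) ⟩
    a ⁻¹ * (e * a * c ⁻¹)   ≈⟨ *-congˡ (solve 3 (λ e a c' → (e ⊕ a) ⊕ c' ⊜ a ⊕ (e ⊕ c')) refl e a (c ⁻¹)) ⟩
    a ⁻¹ * (a * (e * c ⁻¹)) ≈⟨ ⁻¹-cancelʳ _ a≉0 ⟩
    e * c ⁻¹                ∎

  NonNegative : Carrier → Set _
  NonNegative x = x ≈ 0# ⊎ 0# < x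

  +-pos : ∀ {x y} → 0# < x → 0# < y → 0# < x + y
  +-pos {x} {y} 0<x 0<y = <-trans (<-respʳ-≈ (sym (+-identityˡ y)) 0<y) (+-mono-< y 0<x)

  +-pos-nonneg : ∀ {x y} → 0# < x → NonNegative y → 0# < x + y
  +-pos-nonneg 0<x (inj₁ y≈0) = <-respʳ-≈ (trans (sym (+-identityʳ _)) (+-congˡ (sym y≈0))) 0<x
  +-pos-nonneg 0<x (inj₂ 0<y) = +-pos 0<x 0<y

  +-nonneg-pos : ∀ {x y} → NonNegative x → 0# < y → 0# < x + y
  +-nonneg-pos {x} {y} x≥0 0<y = <-respʳ-≈ (+-comm y x) (+-pos-nonneg 0<y x≥0)

  +-nonneg : ∀ {x y} → NonNegative x → NonNegative y → NonNegative (x + y)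
  +-nonneg (inj₁ x≈0) (inj₁ y≈0) = inj₁ (trans (+-cong x≈0 y≈0) (+-identityˡ 0#))
  +-nonneg (inj₁ x≈0) (inj₂ 0<y) = inj₂ (+-nonneg-pos (inj₁ x≈0) 0<y)
  +-nonneg (inj₂ 0<x) y≥0        = inj₂ (+-pos-nonneg 0<x y≥0)

  fromℕ-suc>0 : ∀ m → 0# < fromℕ F (suc m)
  fromℕ-suc>0 zero    = <-respʳ-≈ (sym (+-identityʳ 1#)) 0<1
  fromℕ-suc>0 (suc m) = +-pos 0<1 (fromℕ-suc>0 m)

  fromℕ-≢0 : ∀ {m} → m ≢ 0 → fromℕ F m ≉ 0#
  fromℕ-≢0 {zero}  m≢0 = ⊥-elim (m≢0 P.refl)
  fromℕ-≢0 {suc m} _   = >0⇒≉0 (fromℕ-suc>0 m)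

module Binomial where
  open import Data.Nat.Properties
  open import Data.Nat.Combinatorics using (nCk+nC[k+1]≡[n+1]C[k+1]; k>n⇒nCk≡0; nC1≡n; nCk≡nC[n∸k])
  open P.≡-Reasoning

  [1+n]Cn≡1+n : ∀ n → suc n C n ≡ suc n
  [1+n]Cn≡1+n n = P.trans (nCk≡nC[n∸k] (n≤1+n n)) (P.trans (P.cong (suc n C_) (m+n∸n≡m 1 n)) (nC1≡n (suc n)))

  nCk≢0 : ∀ {n k} → k ≤ n → n C k ≢ 0
  nCk≢0 {n}     {zero}  _         ()
  nCk≢0 {suc n} {suc k} (s≤s k≤n) nCk≡0 =
    nCk≢0 k≤n (m+n≡0⇒m≡0 (n C k) (P.trans (nCk+nC[k+1]≡[n+1]C[k+1] n k) nCk≡0))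

  [n∸k]*nCk≡[k+1]*nC[k+1] : ∀ n k → (n ∸ k) *ℕ (n C k) ≡ suc k *ℕ (n C suc k)
  [n∸k]*nCk≡[k+1]*nC[k+1] zero    zero    = P.refl
  [n∸k]*nCk≡[k+1]*nC[k+1] zero    (suc k) = P.sym (*-zeroʳ (suc (suc k)))
  [n∸k]*nCk≡[k+1]*nC[k+1] (suc n) zero    = P.trans (*-identityʳ (suc n)) (P.sym (P.trans (+-identityʳ _) (nC1≡n (suc n))))
  [n∸k]*nCk≡[k+1]*nC[k+1] (suc n) (suc k) = begin
    (n ∸ k) *ℕ (suc n C suc k)                            ≡⟨ P.cong ((n ∸ k) *ℕ_) (nCk+nC[k+1]≡[n+1]C[k+1] n k) ⟨
    (n ∸ k) *ℕ (n C k +ℕ X)                               ≡⟨ *-distribˡ-+ (n ∸ k) (n C k) X ⟩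
    (n ∸ k) *ℕ (n C k) +ℕ (n ∸ k) *ℕ X                    ≡⟨ P.cong (_+ℕ (n ∸ k) *ℕ X) ([n∸k]*nCk≡[k+1]*nC[k+1] n k) ⟩
    suc k *ℕ X +ℕ (n ∸ k) *ℕ X                            ≡⟨ *-distribʳ-+ X (suc k) (n ∸ k) ⟨
    (suc k +ℕ (n ∸ k)) *ℕ X                               ≡⟨ shift ⟩
    (suc (suc k) +ℕ (n ∸ suc k)) *ℕ X                     ≡⟨ *-distribʳ-+ X (suc (suc k)) (n ∸ suc k) ⟩
    suc (suc k) *ℕ X +ℕ (n ∸ suc k) *ℕ X                  ≡⟨ P.cong (suc (suc k) *ℕ X +ℕ_) ([n∸k]*nCk≡[k+1]*nC[k+1] n (suc k)) ⟩
    suc (suc k) *ℕ X +ℕ suc (suc k) *ℕ (n C suc (suc k))  ≡⟨ *-distribˡ-+ (suc (suc k)) X _ ⟨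
    suc (suc k) *ℕ (X +ℕ n C suc (suc k))                 ≡⟨ P.cong (suc (suc k) *ℕ_) (nCk+nC[k+1]≡[n+1]C[k+1] n (suc k)) ⟩
    suc (suc k) *ℕ (suc n C suc (suc k))                  ∎
    where
    X = n C suc k
    shift : (suc k +ℕ (n ∸ k)) *ℕ X ≡ (suc (suc k) +ℕ (n ∸ suc k)) *ℕ X
    shift with suc k ≤? n
    ... | yes k<n = P.trans (P.cong (λ m → (suc k +ℕ m) *ℕ X) (+-∸-assoc 1 k<n)) (P.cong (_*ℕ X) (+-suc (suc k) (n ∸ suc k)))
    ... | no  k≮n rewrite k>n⇒nCk≡0 (≰⇒> k≮n) = P.trans (*-zeroʳ (suc k +ℕ (n ∸ k))) (P.sym (*-zeroʳ (suc (suc k) +ℕ (n ∸ suc k))))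

module SubsetProperties where
  open import Data.Nat.Properties using (+-suc; ≡ᵇ⇒≡; ≡⇒≡ᵇ)
  open import Data.Fin.Subset.Properties using (p⊆p∪q; q⊆p∪q; x∈p∪q⁻; ⊆-trans; drop-∷-⊆; s⊆s; out⊆)
  import Data.Vec.Base as Vec
  open import Data.Bool.Properties using (T-≡)
  open import Function.Bundles using (Equivalence)

  ∧-true⁻ : ∀ a {b} → a ∧ b ≡ true → a ≡ true × b ≡ true
  ∧-true⁻ true b≡true = P.refl , b≡true

  ≡ᵇ-true⇒≡ : ∀ {m n} → (m ≡ᵇ n) ≡ true → m ≡ n
  ≡ᵇ-true⇒≡ {m} {n} e = ≡ᵇ⇒≡ m n (Equivalence.from T-≡ e)

  ≡⇒≡ᵇ-true : ∀ {m n} → m ≡ n → (m ≡ᵇ n) ≡ true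
  ≡⇒≡ᵇ-true {m} {n} e = Equivalence.to T-≡ (≡⇒≡ᵇ m n e)

  ⊆ᵇ-sound : ∀ {n} (p q : Subset n) → p ⊆ᵇ q ≡ true → p ⊆ q
  ⊆ᵇ-sound []          []          _   ()
  ⊆ᵇ-sound (true  ∷ p) (true  ∷ q) p⊆q = s⊆s (⊆ᵇ-sound p q p⊆q)
  ⊆ᵇ-sound (false ∷ p) (_     ∷ q) p⊆q = out⊆ (⊆ᵇ-sound p q p⊆q)

  ⊆ᵇ-complete : ∀ {n} (p q : Subset n) → p ⊆ q → p ⊆ᵇ q ≡ true
  ⊆ᵇ-complete []          []          _   = P.refl
  ⊆ᵇ-complete (true  ∷ p) (true  ∷ q) p⊆q = ⊆ᵇ-complete p q (drop-∷-⊆ p⊆q)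
  ⊆ᵇ-complete (true  ∷ p) (false ∷ q) p⊆q with () ← p⊆q Vec.here
  ⊆ᵇ-complete (false ∷ p) (_     ∷ q) p⊆q = ⊆ᵇ-complete p q (drop-∷-⊆ p⊆q)

  ∪-⊆ : ∀ {n} {p q r : Subset n} → p ⊆ r → q ⊆ r → p ∪ q ⊆ r
  ∪-⊆ {p = p} {q} p⊆r q⊆r x∈p∪q with x∈p∪q⁻ p q x∈p∪q
  ... | inj₁ x∈p = p⊆r x∈p
  ... | inj₂ x∈q = q⊆r x∈q

  ∪-monoˡ-⊆ : ∀ {n} {p q : Subset n} (r : Subset n) → p ⊆ q → p ∪ r ⊆ q ∪ r
  ∪-monoˡ-⊆ {q = q} r p⊆q = ∪-⊆ (⊆-trans p⊆q (p⊆p∪q r)) (q⊆p∪q q r)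

  disjointᵇ-∪ˡ : ∀ {n} (p q r : Subset n) → disjointᵇ (p ∪ q) r ≡ disjointᵇ p r ∧ disjointᵇ q r
  disjointᵇ-∪ˡ []          []          []          = P.refl
  disjointᵇ-∪ˡ (true  ∷ p) (_     ∷ q) (true  ∷ r) = P.refl
  disjointᵇ-∪ˡ (false ∷ p) (true  ∷ q) (true  ∷ r) = P.sym (∧-zeroʳ (disjointᵇ p r))
  disjointᵇ-∪ˡ (false ∷ p) (false ∷ q) (true  ∷ r) = disjointᵇ-∪ˡ p q r
  disjointᵇ-∪ˡ (true  ∷ p) (true  ∷ q) (false ∷ r) = disjointᵇ-∪ˡ p q r
  disjointᵇ-∪ˡ (true  ∷ p) (false ∷ q) (false ∷ r) = disjointᵇ-∪ˡ p q r
  disjointᵇ-∪ˡ (false ∷ p) (true  ∷ q) (false ∷ r) = disjointᵇ-∪ˡ p q r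
  disjointᵇ-∪ˡ (false ∷ p) (false ∷ q) (false ∷ r) = disjointᵇ-∪ˡ p q r

  disjointᵇ-∅ : ∀ {n} (p : Subset n) → disjointᵇ p ∅ ≡ true
  disjointᵇ-∅ []          = P.refl
  disjointᵇ-∅ (true  ∷ p) = disjointᵇ-∅ p
  disjointᵇ-∅ (false ∷ p) = disjointᵇ-∅ p

  ∣p∪q∣≡∣p∣+∣q∣ : ∀ {n} (p q : Subset n) → disjointᵇ p q ≡ true → ∣ p ∪ q ∣ ≡ ∣ p ∣ +ℕ ∣ q ∣
  ∣p∪q∣≡∣p∣+∣q∣ []          []          _ = P.refl
  ∣p∪q∣≡∣p∣+∣q∣ (true  ∷ p) (false ∷ q) e = P.cong suc (∣p∪q∣≡∣p∣+∣q∣ p q e)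
  ∣p∪q∣≡∣p∣+∣q∣ (false ∷ p) (true  ∷ q) e = P.trans (P.cong suc (∣p∪q∣≡∣p∣+∣q∣ p q e)) (P.sym (+-suc _ _))
  ∣p∪q∣≡∣p∣+∣q∣ (false ∷ p) (false ∷ q) e = ∣p∪q∣≡∣p∣+∣q∣ p q e

  ∣p∣+∣q─p∣≡∣p∪q∣ : ∀ {n} (p q : Subset n) → ∣ p ∣ +ℕ ∣ q ─ p ∣ ≡ ∣ p ∪ q ∣
  ∣p∣+∣q─p∣≡∣p∪q∣ []          []          = P.refl
  ∣p∣+∣q─p∣≡∣p∪q∣ (true  ∷ p) (_     ∷ q) = P.cong suc (∣p∣+∣q─p∣≡∣p∪q∣ p q)
  ∣p∣+∣q─p∣≡∣p∪q∣ (false ∷ p) (true  ∷ q) = P.trans (+-suc _ _) (P.cong suc (∣p∣+∣q─p∣≡∣p∪q∣ p q))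
  ∣p∣+∣q─p∣≡∣p∪q∣ (false ∷ p) (false ∷ q) = ∣p∣+∣q─p∣≡∣p∪q∣ p q

  [q─p]∪p≡p∪q : ∀ {n} (p q : Subset n) → (q ─ p) ∪ p ≡ p ∪ q
  [q─p]∪p≡p∪q []          []          = P.refl
  [q─p]∪p≡p∪q (true  ∷ p) (true  ∷ q) = P.cong (true  ∷_) ([q─p]∪p≡p∪q p q)
  [q─p]∪p≡p∪q (true  ∷ p) (false ∷ q) = P.cong (true  ∷_) ([q─p]∪p≡p∪q p q)
  [q─p]∪p≡p∪q (false ∷ p) (true  ∷ q) = P.cong (true  ∷_) ([q─p]∪p≡p∪q p q)
  [q─p]∪p≡p∪q (false ∷ p) (false ∷ q) = P.cong (false ∷_) ([q─p]∪p≡p∪q p q)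

  p⊆q⇒p∪q≡q : ∀ {n} (p q : Subset n) → p ⊆ᵇ q ≡ true → p ∪ q ≡ q
  p⊆q⇒p∪q≡q []          []          _ = P.refl
  p⊆q⇒p∪q≡q (true  ∷ p) (true  ∷ q) e = P.cong (true ∷_) (p⊆q⇒p∪q≡q p q e)
  p⊆q⇒p∪q≡q (false ∷ p) (b     ∷ q) e = P.cong (b ∷_) (p⊆q⇒p∪q≡q p q e)

  allSubsets-complete : ∀ {n} (p : Subset n) → p ∈ allSubsets n
  allSubsets-complete []                  = here P.refl
  allSubsets-complete {suc n} (true  ∷ p) = ∈-++⁺ˡ (∈-map⁺ (true ∷_) (allSubsets-complete p))
  allSubsets-complete {suc n} (false ∷ p) = ∈-++⁺ʳ (map (true ∷_) (allSubsets n)) (∈-map⁺ (false ∷_) (allSubsets-complete p))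

module Sums {c ℓ : Level} (F : OrderedField c ℓ) where
  open OrderedField F
  open FieldProperties F using (NonNegative; +-nonneg; +-pos-nonneg; +-nonneg-pos)
  open SetoidReasoning setoid

  private variable A B : Set

  -- The same fold as in sumDim, so that sumDim Y k g unfolds to a sumAll of guarded terms.
  sumList : List A → (A → Carrier) → Carrier
  sumList xs g = foldr (λ x acc → g x + acc) 0# xs

  sumList-cong : ∀ (xs : List A) {g h : A → Carrier} → (∀ x → g x ≈ h x) → sumList xs g ≈ sumList xs h
  sumList-cong []       g≈h = refl
  sumList-cong (x ∷ xs) g≈h = +-cong (g≈h x) (sumList-cong xs g≈h)

  sumList-0 : ∀ (xs : List A) → sumList xs (λ _ → 0#) ≈ 0#
  sumList-0 []       = refl
  sumList-0 (x ∷ xs) = trans (+-identityˡ _) (sumList-0 xs)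

  sumList-+ : ∀ (xs : List A) (g h : A → Carrier) →
              sumList xs (λ x → g x + h x) ≈ sumList xs g + sumList xs h
  sumList-+ []       g h = sym (+-identityˡ 0#)
  sumList-+ (x ∷ xs) g h = begin
    g x + h x + sumList xs (λ x → g x + h x)          ≈⟨ +-congˡ (sumList-+ xs g h) ⟩
    g x + h x + (sumList xs g + sumList xs h)         ≈⟨ +-assoc _ _ _ ⟩
    g x + (h x + (sumList xs g + sumList xs h))       ≈⟨ +-congˡ (trans (sym (+-assoc _ _ _)) (+-congʳ (+-comm _ _))) ⟩
    g x + (sumList xs g + h x + sumList xs h)         ≈⟨ +-congˡ (+-assoc _ _ _) ⟩
    g x + (sumList xs g + (h x + sumList xs h))       ≈⟨ +-assoc _ _ _ ⟨
    g x + sumList xs g + (h x + sumList xs h)         ∎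

  sumList-*ˡ : ∀ (xs : List A) a (g : A → Carrier) → sumList xs (λ x → a * g x) ≈ a * sumList xs g
  sumList-*ˡ []       a g = sym (zeroʳ a)
  sumList-*ˡ (x ∷ xs) a g = trans (+-congˡ (sumList-*ˡ xs a g)) (sym (distribˡ _ _ _))

  sumList-*ʳ : ∀ (xs : List A) a (g : A → Carrier) → sumList xs (λ x → g x * a) ≈ sumList xs g * a
  sumList-*ʳ xs a g = trans (sumList-cong xs (λ x → *-comm (g x) a)) (trans (sumList-*ˡ xs a g) (*-comm _ _))

  sumList-++ : ∀ (xs ys : List A) (g : A → Carrier) → sumList (xs ++ ys) g ≈ sumList xs g + sumList ys g
  sumList-++ []       ys g = sym (+-identityˡ _)
  sumList-++ (x ∷ xs) ys g = trans (+-congˡ (sumList-++ xs ys g)) (sym (+-assoc _ _ _))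

  sumList-map : (xs : List B) (h : B → A) (g : A → Carrier) →
                sumList (map h xs) g ≈ sumList xs (λ x → g (h x))
  sumList-map []       h g = refl
  sumList-map (x ∷ xs) h g = +-congˡ (sumList-map xs h g)

  sumList-comm : (xs : List A) (ys : List B) (g : A → B → Carrier) →
                 sumList xs (λ x → sumList ys (g x)) ≈ sumList ys (λ y → sumList xs (λ x → g x y))
  sumList-comm []       ys g = sym (sumList-0 ys)
  sumList-comm (x ∷ xs) ys g = trans (+-congˡ (sumList-comm xs ys g)) (sym (sumList-+ ys (g x) _))

  sumList-nonneg : ∀ (xs : List A) (g : A → Carrier) → (∀ x → NonNegative (g x)) → NonNegative (sumList xs g)
  sumList-nonneg []       g g≥0 = inj₁ refl
  sumList-nonneg (x ∷ xs) g g≥0 = +-nonneg (g≥0 x) (sumList-nonneg xs g g≥0)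

  sumList-pos : ∀ (xs : List A) (g : A → Carrier) → (∀ x → NonNegative (g x)) →
                ∀ {x} → x ∈ xs → 0# < g x → 0# < sumList xs g
  sumList-pos (x ∷ xs) g g≥0 (here P.refl) 0<gx = +-pos-nonneg 0<gx (sumList-nonneg xs g g≥0)
  sumList-pos (y ∷ xs) g g≥0 (there x∈xs)  0<gx = +-nonneg-pos (g≥0 y) (sumList-pos xs g g≥0 x∈xs 0<gx)

  sumAll : ∀ {n} → (Subset n → Carrier) → Carrier
  sumAll {n} = sumList (allSubsets n)

  sumAll-cong : ∀ {n} {g h : Subset n → Carrier} → (∀ σ → g σ ≈ h σ) → sumAll g ≈ sumAll h
  sumAll-cong {n} = sumList-cong (allSubsets n)

  sumAll-suc : ∀ {n} (g : Subset (suc n) → Carrier) →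
               sumAll g ≈ sumAll (λ σ → g (true ∷ σ)) + sumAll (λ σ → g (false ∷ σ))
  sumAll-suc {n} g = trans (sumList-++ (map (true ∷_) (allSubsets n)) _ g)
                           (+-cong (sumList-map (allSubsets n) (true ∷_) g) (sumList-map (allSubsets n) (false ∷_) g))

  sumAll-*ˡ : ∀ {n} a (g : Subset n → Carrier) → sumAll (λ σ → a * g σ) ≈ a * sumAll g
  sumAll-*ˡ {n} = sumList-*ˡ (allSubsets n)

  sumAll-comm : ∀ {n} (g : Subset n → Subset n → Carrier) →
                sumAll (λ σ → sumAll (g σ)) ≈ sumAll (λ τ → sumAll (λ σ → g σ τ))
  sumAll-comm {n} = sumList-comm (allSubsets n) (allSubsets n)

  sumAll² : ∀ {n} → (Subset n → Subset n → Carrier) → Carrier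
  sumAll² g = sumAll (λ σ → sumAll (g σ))

  sumAll²-cong : ∀ {n} {g h : Subset n → Subset n → Carrier} → (∀ σ τ → g σ τ ≈ h σ τ) → sumAll² g ≈ sumAll² h
  sumAll²-cong g≈h = sumAll-cong (λ σ → sumAll-cong (g≈h σ))

  sumAll²-*ˡ : ∀ {n} a (g : Subset n → Subset n → Carrier) → sumAll² (λ σ τ → a * g σ τ) ≈ a * sumAll² g
  sumAll²-*ˡ a g = trans (sumAll-cong (λ σ → sumAll-*ˡ a (g σ))) (sumAll-*ˡ a (λ σ → sumAll (g σ)))

  guard : Bool → Carrier → Carrier
  guard b x = if b then x else 0#

  guard-∧ : ∀ a b x → guard (a ∧ b) x ≡ guard a (guard b x)
  guard-∧ true  b x = P.refl
  guard-∧ false b x = P.refl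

  guard-*ˡ : ∀ b x y → guard b (x * y) ≈ x * guard b y
  guard-*ˡ true  x y = refl
  guard-*ˡ false x y = sym (zeroʳ x)

  guard-*ʳ : ∀ b x y → guard b (x * y) ≈ guard b x * y
  guard-*ʳ true  x y = refl
  guard-*ʳ false x y = sym (zeroˡ y)

  guard-sumAll : ∀ {n} b (g : Subset n → Carrier) → guard b (sumAll g) ≈ sumAll (λ σ → guard b (g σ))
  guard-sumAll {n} true  g = refl
  guard-sumAll {n} false g = sym (sumList-0 (allSubsets n))

  guard-sumAll² : ∀ {n} b (c : Subset n → Subset n → Bool) (g : Subset n → Subset n → Carrier) →
                  guard b (sumAll² (λ σ τ → guard (c σ τ) (g σ τ))) ≈ sumAll² (λ σ τ → guard (b ∧ c σ τ) (g σ τ))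
  guard-sumAll² {n} true  c g = refl
  guard-sumAll² {n} false c g = sym (trans (sumAll-cong {n} (λ _ → sumList-0 (allSubsets n))) (sumList-0 (allSubsets n)))

  guard-congʳ : ∀ b {x y} → (b ≡ true → x ≈ y) → guard b x ≈ guard b y
  guard-congʳ true  x≈y = x≈y P.refl
  guard-congʳ false x≈y = refl

  guard-nonneg : ∀ b {x} → (b ≡ true → NonNegative x) → NonNegative (guard b x)
  guard-nonneg true  x≥0 = x≥0 P.refl
  guard-nonneg false x≥0 = inj₁ refl

module VertexCounting {c ℓ : Level} (F : OrderedField c ℓ) where
  open OrderedField F
  open Sums F
  open SubsetProperties using (⊆ᵇ-complete; disjointᵇ-∅)
  open import Data.Fin.Subset.Properties using (⊆-min)
  open SetoidReasoning setoid

  sumAll-∅ : ∀ {n} (g : Subset n → Carrier) → sumAll (λ v → guard (∣ v ∣ ≡ᵇ 0) (g v)) ≈ g ∅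
  sumAll-∅ {zero}  g = +-identityʳ (g [])
  sumAll-∅ {suc n} g = begin
    sumAll (λ v → guard (∣ v ∣ ≡ᵇ 0) (g v))
      ≈⟨ sumAll-suc (λ v → guard (∣ v ∣ ≡ᵇ 0) (g v)) ⟩
    sumAll {n} (λ _ → 0#) + sumAll (λ v → guard (∣ v ∣ ≡ᵇ 0) (g (false ∷ v)))
      ≈⟨ +-cong (sumList-0 (allSubsets n)) (sumAll-∅ (λ v → g (false ∷ v))) ⟩
    0# + g ∅
      ≈⟨ +-identityˡ (g ∅) ⟩
    g ∅
      ∎

  outsideVertexᵇ : ∀ {n} → Subset n → Subset n → Subset n → Bool
  outsideVertexᵇ η ρ v = (∣ v ∣ ≡ᵇ 1) ∧ (disjointᵇ η v ∧ (v ⊆ᵇ ρ))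

  count-outsideVertices : ∀ {n} (η ρ : Subset n) → sumAll (λ v → guard (outsideVertexᵇ η ρ v) 1#) ≈ fromℕ F ∣ ρ ─ η ∣
  count-outsideVertices []      []      = +-identityˡ 0#
  count-outsideVertices {suc n} (a ∷ η) (b ∷ ρ) =
    trans (sumAll-suc (λ v → guard (outsideVertexᵇ (a ∷ η) (b ∷ ρ) v) 1#)) (trans (+-cong (firstPoint a b) (otherPoints a)) (combine a b))
    where
    firstPoint : ∀ a b → sumAll (λ v → guard (outsideVertexᵇ (a ∷ η) (b ∷ ρ) (true ∷ v)) 1#) ≈ guard (not a ∧ b) 1#
    firstPoint a b = trans (sumAll-cong {n} (λ v → reflexive (guard-∧ (∣ v ∣ ≡ᵇ 0) _ 1#)))
                        (trans (sumAll-∅ (λ v → guard (disjointᵇ (a ∷ η) (true ∷ v) ∧ ((true ∷ v) ⊆ᵇ (b ∷ ρ))) 1#)) (reflexive (atEmpty a b)))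
      where
      atEmpty : ∀ a b → guard (disjointᵇ (a ∷ η) (true ∷ ∅) ∧ ((true ∷ ∅) ⊆ᵇ (b ∷ ρ))) 1# ≡ guard (not a ∧ b) 1#
      atEmpty true  b     = P.refl
      atEmpty false false rewrite disjointᵇ-∅ η = P.refl
      atEmpty false true  rewrite disjointᵇ-∅ η | ⊆ᵇ-complete ∅ ρ (⊆-min ρ) = P.refl
    otherPoints : ∀ a → sumAll (λ v → guard (outsideVertexᵇ (a ∷ η) (b ∷ ρ) (false ∷ v)) 1#) ≈ fromℕ F ∣ ρ ─ η ∣
    otherPoints true  = count-outsideVertices η ρ
    otherPoints false = count-outsideVertices η ρ
    combine : ∀ a b → guard (not a ∧ b) 1# + fromℕ F ∣ ρ ─ η ∣ ≈ fromℕ F ∣ (b ∷ ρ) ─ (a ∷ η) ∣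
    combine true  true  = +-identityˡ _
    combine true  false = +-identityˡ _
    combine false false = +-identityˡ _
    combine false true  = refl

  sum-outsideVertices : ∀ {n} (η ρ : Subset n) x → sumAll (λ v → guard (outsideVertexᵇ η ρ v) x) ≈ fromℕ F ∣ ρ ─ η ∣ * x
  sum-outsideVertices {n} η ρ x = begin
    sumAll (λ v → guard (outsideVertexᵇ η ρ v) x)         ≈⟨ sumAll-cong (λ v → trans (guard-congʳ (outsideVertexᵇ η ρ v) (λ _ → sym (*-identityˡ x))) (guard-*ʳ _ 1# x)) ⟩
    sumAll (λ v → guard (outsideVertexᵇ η ρ v) 1# * x)    ≈⟨ sumList-*ʳ (allSubsets n) x _ ⟩
    sumAll (λ v → guard (outsideVertexᵇ η ρ v) 1#) * x    ≈⟨ *-congʳ (count-outsideVertices η ρ) ⟩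
    fromℕ F ∣ ρ ─ η ∣ * x                                 ∎

module WalkQuadraticForm {c ℓ : Level} (F : OrderedField c ℓ) where
  open OrderedField F
  open FieldProperties F
  open Sums F
  open SubsetProperties
  open Binomial
  open SetoidReasoning setoid
  open CommutativeMonoidSolver *-commutativeMonoid using (solve; _⊕_; _⊜_)
  open import Data.Nat.Properties using (m≤m+n)

  *-linkW : ∀ {n} (wY : Subset n → Carrier) (σ ρ : Subset n) → wY σ ≉ 0# →
            wY σ * linkW F wY σ ρ ≈ fromℕ F ((∣ σ ∣ +ℕ ∣ ρ ∣) C ∣ σ ∣) ⁻¹ * wY (ρ ∪ σ)
  *-linkW wY σ ρ wσ≉0 = begin
    wY σ * (wY (ρ ∪ σ) * (B * wY σ) ⁻¹)          ≈⟨ *-congˡ (*-congˡ (⁻¹-distrib-* B≉0 wσ≉0)) ⟩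
    wY σ * (wY (ρ ∪ σ) * (B ⁻¹ * wY σ ⁻¹))       ≈⟨ *-congˡ (solve 3 (λ w b w' → w ⊕ (b ⊕ w') ⊜ w' ⊕ (b ⊕ w)) refl (wY (ρ ∪ σ)) (B ⁻¹) (wY σ ⁻¹)) ⟩
    wY σ * (wY σ ⁻¹ * (B ⁻¹ * wY (ρ ∪ σ)))       ≈⟨ ⁻¹-cancelˡ _ wσ≉0 ⟩
    B ⁻¹ * wY (ρ ∪ σ)                           ∎
    where
    B = fromℕ F ((∣ σ ∣ +ℕ ∣ ρ ∣) C ∣ σ ∣)
    B≉0 : B ≉ 0#
    B≉0 = fromℕ-≢0 (nCk≢0 (m≤m+n ∣ σ ∣ ∣ ρ ∣))

  *-linkW-edge : ∀ {n} (wY : Subset n → Carrier) {k} (σ τ : Subset n) → wY σ ≉ 0# →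
                 ∣ σ ∣ ≡ suc k → ∣ σ ∪ τ ∣ ≡ suc (suc k) →
                 wY σ * linkW F wY σ (τ ─ σ) ≈ fromℕ F (suc (suc k)) ⁻¹ * wY (σ ∪ τ)
  *-linkW-edge wY {k} σ τ wσ≉0 ∣σ∣≡k+1 ∣σ∪τ∣≡k+2 =
    trans (*-linkW wY σ (τ ─ σ) wσ≉0) (reflexive (P.cong₂ (λ m ρ → fromℕ F m ⁻¹ * wY ρ) binomial ([q─p]∪p≡p∪q σ τ)))
    where
    binomial : (∣ σ ∣ +ℕ ∣ τ ─ σ ∣) C ∣ σ ∣ ≡ suc (suc k)
    binomial = P.trans (P.cong₂ _C_ (P.trans (∣p∣+∣q─p∣≡∣p∪q∣ σ τ) ∣σ∪τ∣≡k+2) ∣σ∣≡k+1) ([1+n]Cn≡1+n (suc k))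

  adjacentᵇ : ∀ {n} → Complex n → ℕ → Subset n → Subset n → Bool
  adjacentᵇ Y k σ τ = inDim Y k σ ∧ (inDim Y k τ ∧ inDim Y (suc k) (σ ∪ τ))

  edgeForm : ∀ {n} → Complex n → (Subset n → Carrier) → ℕ → (Subset n → Carrier) → Carrier
  edgeForm Y wY k f = sumAll² (λ σ τ → guard (adjacentᵇ Y k σ τ) (wY (σ ∪ τ) * (f σ * f τ)))

  walkScale : ℕ → Carrier
  walkScale k = fromℕ F (suc k) ⁻¹ * fromℕ F (suc (suc k)) ⁻¹

  inner-walk : ∀ {n} (Y : Complex n) (wY : Subset n → Carrier) k (f : Subset n → Carrier) →
               (∀ σ → inDim Y k σ ≡ true → wY σ ≉ 0#) →
               inner F Y wY k (walk F Y wY k f) f ≈ walkScale k * edgeForm Y wY k f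
  inner-walk {n} Y wY k f wY≉0 = trans (sumAll-cong atFace) (sumList-*ˡ (allSubsets n) (walkScale k) _)
    where
    atFace : ∀ σ → guard (inDim Y k σ) (wY σ * (walk F Y wY k f σ * f σ))
                   ≈ walkScale k * sumAll (λ τ → guard (adjacentᵇ Y k σ τ) (wY (σ ∪ τ) * (f σ * f τ)))
    atFace σ with inDim Y k σ in σ∈Yk
    ... | false = sym (trans (*-congˡ (sumList-0 (allSubsets n))) (zeroʳ _))
    ... | true  = begin
      wY σ * ((a * sumAll h) * f σ)                  ≈⟨ solve 4 (λ w a s x → w ⊕ ((a ⊕ s) ⊕ x) ⊜ (a ⊕ (w ⊕ x)) ⊕ s) refl (wY σ) a (sumAll h) (f σ) ⟩
      (a * (wY σ * f σ)) * sumAll h                  ≈⟨ sumList-*ˡ (allSubsets n) _ h ⟨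
      sumAll (λ τ → (a * (wY σ * f σ)) * h τ)        ≈⟨ sumAll-cong atEdge ⟩
      sumAll (λ τ → walkScale k * guard (b τ) (wY (σ ∪ τ) * (f σ * f τ)))  ≈⟨ sumList-*ˡ (allSubsets n) _ _ ⟩
      walkScale k * sumAll (λ τ → guard (b τ) (wY (σ ∪ τ) * (f σ * f τ)))  ∎
      where
      a = fromℕ F (suc k) ⁻¹
      b : Subset n → Bool
      b τ = inDim Y k τ ∧ inDim Y (suc k) (σ ∪ τ)
      h : Subset n → Carrier
      h τ = guard (inDim Y k τ) (guard (inDim Y (suc k) (σ ∪ τ)) (linkW F wY σ (τ ─ σ) * f τ))
      ∣σ∣≡k+1 : ∣ σ ∣ ≡ suc k
      ∣σ∣≡k+1 = ≡ᵇ-true⇒≡ (proj₂ (∧-true⁻ (Y σ) σ∈Yk))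
      atEdge : ∀ τ → (a * (wY σ * f σ)) * h τ ≈ walkScale k * guard (b τ) (wY (σ ∪ τ) * (f σ * f τ))
      atEdge τ = begin
        (a * (wY σ * f σ)) * h τ                                          ≡⟨ P.cong ((a * (wY σ * f σ)) *_) (guard-∧ (inDim Y k τ) _ _) ⟨
        (a * (wY σ * f σ)) * guard (b τ) (linkW F wY σ (τ ─ σ) * f τ)     ≈⟨ guard-*ˡ (b τ) _ _ ⟨
        guard (b τ) ((a * (wY σ * f σ)) * (linkW F wY σ (τ ─ σ) * f τ))   ≈⟨ guard-congʳ (b τ) edge ⟩
        guard (b τ) (walkScale k * (wY (σ ∪ τ) * (f σ * f τ)))            ≈⟨ guard-*ˡ (b τ) _ _ ⟩
        walkScale k * guard (b τ) (wY (σ ∪ τ) * (f σ * f τ))              ∎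
        where
        edge : b τ ≡ true → (a * (wY σ * f σ)) * (linkW F wY σ (τ ─ σ) * f τ) ≈ walkScale k * (wY (σ ∪ τ) * (f σ * f τ))
        edge bτ = begin
          (a * (wY σ * f σ)) * (linkW F wY σ (τ ─ σ) * f τ)            ≈⟨ solve 5 (λ a w x l y → (a ⊕ (w ⊕ x)) ⊕ (l ⊕ y) ⊜ (a ⊕ (x ⊕ y)) ⊕ (w ⊕ l)) refl a (wY σ) (f σ) _ (f τ) ⟩
          (a * (f σ * f τ)) * (wY σ * linkW F wY σ (τ ─ σ))            ≈⟨ *-congˡ (*-linkW-edge wY σ τ (wY≉0 σ σ∈Yk) ∣σ∣≡k+1 ∣σ∪τ∣≡k+2) ⟩
          (a * (f σ * f τ)) * (fromℕ F (suc (suc k)) ⁻¹ * wY (σ ∪ τ))  ≈⟨ solve 4 (λ a x b w → (a ⊕ x) ⊕ (b ⊕ w) ⊜ (a ⊕ b) ⊕ (w ⊕ x)) refl a (f σ * f τ) _ (wY (σ ∪ τ)) ⟩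
          walkScale k * (wY (σ ∪ τ) * (f σ * f τ))                    ∎
          where
          ∣σ∪τ∣≡k+2 : ∣ σ ∪ τ ∣ ≡ suc (suc k)
          ∣σ∪τ∣≡k+2 = ≡ᵇ-true⇒≡ (proj₂ (∧-true⁻ (Y (σ ∪ τ)) (proj₂ (∧-true⁻ (inDim Y k τ) bτ))))

IsDownwardClosed : ∀ {n} → Complex n → Set
IsDownwardClosed {n} X = ∀ (σ τ : Subset n) → τ ⊆ σ → X σ ≡ true → X τ ≡ true

module InducedWeights {c ℓ : Level} (F : OrderedField c ℓ) {n : ℕ} (X : Complex n) (d : ℕ)
                      (wtop : Subset n → OrderedField.Carrier F) where
  open OrderedField F
  open FieldProperties F
  open Sums F
  open VertexCounting F using (outsideVertexᵇ; sum-outsideVertices)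
  open SubsetProperties
  open Binomial
  open SetoidReasoning setoid
  open import Data.Nat.Properties using (m+n∸m≡n; m≤n⇒m≤1+n) renaming (+-comm to ℕ-+-comm)
  open import Data.Fin.Subset.Properties using (p⊆p∪q; q⊆p∪q; ⊆-trans)
  open import Data.Bool.Properties using (⇔→≡)
  open import Function.Bundles using (mk⇔)

  w : Subset n → Carrier
  w = inducedW F X d wtop

  topTerm : Subset n → Subset n → Carrier
  topTerm τ ρ = guard (inDim X d ρ) (guard (τ ⊆ᵇ ρ) (wtop ρ))

  inducedW-≉0 : IsPureComplex X d → (∀ σ → X σ ≡ true → ∣ σ ∣ ≡ suc d → 0# < wtop σ) →
                ∀ τ → X τ ≡ true → w τ ≉ 0#
  inducedW-≉0 (_ , bounded , inFacet) wtop>0 τ τ∈X =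
    *-≉0 (⁻¹-≉0 (fromℕ-≢0 (nCk≢0 (bounded τ τ∈X)))) (>0⇒≉0 topSum>0)
    where
    ρ = proj₁ (inFacet τ τ∈X)
    τ⊆ρ = proj₁ (proj₂ (inFacet τ τ∈X))
    ρ∈X = proj₁ (proj₂ (proj₂ (inFacet τ τ∈X)))
    ∣ρ∣≡d+1 = proj₂ (proj₂ (proj₂ (inFacet τ τ∈X)))
    topTerm≥0 : ∀ ρ → NonNegative (topTerm τ ρ)
    topTerm≥0 ρ = guard-nonneg (inDim X d ρ) (λ ρ∈Xd →
                    let ρ∈X , ∣ρ∣≡ = ∧-true⁻ (X ρ) ρ∈Xd in
                    guard-nonneg (τ ⊆ᵇ ρ) (λ _ → inj₂ (wtop>0 ρ ρ∈X (≡ᵇ-true⇒≡ ∣ρ∣≡))))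
    topTerm>0 : 0# < topTerm τ ρ
    topTerm>0 rewrite ρ∈X | ≡⇒≡ᵇ-true ∣ρ∣≡d+1 | ⊆ᵇ-complete τ ρ τ⊆ρ = wtop>0 ρ ρ∈X ∣ρ∣≡d+1
    topSum>0 : 0# < sumAll (topTerm τ)
    topSum>0 = sumList-pos (allSubsets n) (topTerm τ) topTerm≥0 (allSubsets-complete ρ) topTerm>0

  extendsᵇ : Subset n → Subset n → Bool
  extendsᵇ η v = (∣ v ∣ ≡ᵇ 1) ∧ (disjointᵇ η v ∧ X (η ∪ v))

  extension-in-facet : IsDownwardClosed X → ∀ η ρ v →
    (extendsᵇ η v ∧ (inDim X d ρ ∧ ((η ∪ v) ⊆ᵇ ρ))) ≡ ((inDim X d ρ ∧ (η ⊆ᵇ ρ)) ∧ outsideVertexᵇ η ρ v)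
  extension-in-facet closed η ρ v = ⇔→≡ (mk⇔ to from)
    where
    to : extendsᵇ η v ∧ (inDim X d ρ ∧ ((η ∪ v) ⊆ᵇ ρ)) ≡ true → (inDim X d ρ ∧ (η ⊆ᵇ ρ)) ∧ outsideVertexᵇ η ρ v ≡ true
    to h =
      let ext , facet     = ∧-true⁻ (extendsᵇ η v) h
          ρ∈Xd , η∪v⊆ᵇρ  = ∧-true⁻ (inDim X d ρ) facet
          ∣v∣≡1 , rest    = ∧-true⁻ (∣ v ∣ ≡ᵇ 1) ext
          η#v , _        = ∧-true⁻ (disjointᵇ η v) rest
          η∪v⊆ρ          = ⊆ᵇ-sound (η ∪ v) ρ η∪v⊆ᵇρ
      in P.cong₂ _∧_ (P.cong₂ _∧_ ρ∈Xd (⊆ᵇ-complete η ρ (⊆-trans (p⊆p∪q v) η∪v⊆ρ)))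
                     (P.cong₂ _∧_ ∣v∣≡1 (P.cong₂ _∧_ η#v (⊆ᵇ-complete v ρ (⊆-trans (q⊆p∪q η v) η∪v⊆ρ))))
    from : (inDim X d ρ ∧ (η ⊆ᵇ ρ)) ∧ outsideVertexᵇ η ρ v ≡ true → extendsᵇ η v ∧ (inDim X d ρ ∧ ((η ∪ v) ⊆ᵇ ρ)) ≡ true
    from h =
      let facet , outside = ∧-true⁻ (inDim X d ρ ∧ (η ⊆ᵇ ρ)) h
          ρ∈Xd , η⊆ᵇρ     = ∧-true⁻ (inDim X d ρ) facet
          ∣v∣≡1 , rest    = ∧-true⁻ (∣ v ∣ ≡ᵇ 1) outside
          η#v , v⊆ᵇρ     = ∧-true⁻ (disjointᵇ η v) rest
          η∪v⊆ρ          = ∪-⊆ (⊆ᵇ-sound η ρ η⊆ᵇρ) (⊆ᵇ-sound v ρ v⊆ᵇρ)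
      in P.cong₂ _∧_ (P.cong₂ _∧_ ∣v∣≡1 (P.cong₂ _∧_ η#v (closed ρ (η ∪ v) η∪v⊆ρ (proj₁ (∧-true⁻ (X ρ) ρ∈Xd)))))
                     (P.cong₂ _∧_ ρ∈Xd (⊆ᵇ-complete (η ∪ v) ρ η∪v⊆ρ))

  sum-extensions-inFacet : IsDownwardClosed X → ∀ {j} η → ∣ η ∣ ≡ suc j → ∀ ρ →
                           sumAll (λ v → guard (extendsᵇ η v) (topTerm (η ∪ v) ρ)) ≈ fromℕ F (d ∸ j) * topTerm η ρ
  sum-extensions-inFacet closed {j} η ∣η∣≡j+1 ρ = begin
    sumAll (λ v → guard (extendsᵇ η v) (topTerm (η ∪ v) ρ))              ≈⟨ sumAll-cong regroup ⟩
    sumAll (λ v → guard inFacet (guard (outsideVertexᵇ η ρ v) (wtop ρ)))  ≈⟨ guard-sumAll inFacet (λ v → guard (outsideVertexᵇ η ρ v) (wtop ρ)) ⟨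
    guard inFacet (sumAll (λ v → guard (outsideVertexᵇ η ρ v) (wtop ρ)))  ≈⟨ guard-congʳ inFacet (λ h → trans (sum-outsideVertices η ρ (wtop ρ)) (*-congʳ (reflexive (P.cong (fromℕ F) (∣ρ─η∣ h))))) ⟩
    guard inFacet (fromℕ F (d ∸ j) * wtop ρ)                             ≈⟨ guard-*ˡ inFacet _ _ ⟩
    fromℕ F (d ∸ j) * guard inFacet (wtop ρ)                             ≡⟨ P.cong (fromℕ F (d ∸ j) *_) (guard-∧ (inDim X d ρ) (η ⊆ᵇ ρ) (wtop ρ)) ⟩
    fromℕ F (d ∸ j) * topTerm η ρ                                        ∎
    where
    inFacet : Bool
    inFacet = inDim X d ρ ∧ (η ⊆ᵇ ρ)

    ∣ρ─η∣ : inFacet ≡ true → ∣ ρ ─ η ∣ ≡ d ∸ j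
    ∣ρ─η∣ h = let ρ∈Xd , η⊆ρ = ∧-true⁻ (inDim X d ρ) h in
      P.trans (P.sym (m+n∸m≡n (suc j) ∣ ρ ─ η ∣)) (P.cong (_∸ suc j) (
        P.trans (P.cong (_+ℕ ∣ ρ ─ η ∣) (P.sym ∣η∣≡j+1)) (
        P.trans (∣p∣+∣q─p∣≡∣p∪q∣ η ρ) (
        P.trans (P.cong ∣_∣ (p⊆q⇒p∪q≡q η ρ η⊆ρ))
                (≡ᵇ-true⇒≡ (proj₂ (∧-true⁻ (X ρ) ρ∈Xd)))))))

    regroup : ∀ v → guard (extendsᵇ η v) (topTerm (η ∪ v) ρ) ≈ guard inFacet (guard (outsideVertexᵇ η ρ v) (wtop ρ))
    regroup v = begin
      guard (extendsᵇ η v) (topTerm (η ∪ v) ρ)                                 ≡⟨ P.cong (guard (extendsᵇ η v)) (guard-∧ (inDim X d ρ) _ (wtop ρ)) ⟨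
      guard (extendsᵇ η v) (guard (inDim X d ρ ∧ ((η ∪ v) ⊆ᵇ ρ)) (wtop ρ))      ≡⟨ guard-∧ (extendsᵇ η v) _ (wtop ρ) ⟨
      guard (extendsᵇ η v ∧ (inDim X d ρ ∧ ((η ∪ v) ⊆ᵇ ρ))) (wtop ρ)            ≡⟨ P.cong (λ b → guard b (wtop ρ)) (extension-in-facet closed η ρ v) ⟩
      guard (inFacet ∧ outsideVertexᵇ η ρ v) (wtop ρ)                           ≡⟨ guard-∧ inFacet _ (wtop ρ) ⟩
      guard inFacet (guard (outsideVertexᵇ η ρ v) (wtop ρ))                     ∎

  sum-extensions : IsDownwardClosed X → ∀ {j} → suc j ≤ d → ∀ η → ∣ η ∣ ≡ suc j →
                   sumAll (λ v → guard (extendsᵇ η v) (w (η ∪ v))) ≈ fromℕ F (suc (suc j)) * w η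
  sum-extensions closed {j} j<d η ∣η∣≡j+1 = begin
    sumAll (λ v → guard (extendsᵇ η v) (w (η ∪ v)))          ≈⟨ sumAll-cong expand ⟩
    sumAll (λ v → B₊ ⁻¹ * sumAll (T v))                      ≈⟨ sumList-*ˡ (allSubsets n) _ _ ⟩
    B₊ ⁻¹ * sumAll (λ v → sumAll (T v))                      ≈⟨ *-congˡ (sumList-comm (allSubsets n) (allSubsets n) T) ⟩
    B₊ ⁻¹ * sumAll (λ ρ → sumAll (λ v → T v ρ))              ≈⟨ *-congˡ (sumAll-cong (sum-extensions-inFacet closed η ∣η∣≡j+1)) ⟩
    B₊ ⁻¹ * sumAll (λ ρ → fromℕ F (d ∸ j) * topTerm η ρ)      ≈⟨ *-congˡ (sumList-*ˡ (allSubsets n) _ _) ⟩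
    B₊ ⁻¹ * (fromℕ F (d ∸ j) * sumAll (topTerm η))            ≈⟨ *-assoc _ _ _ ⟨
    B₊ ⁻¹ * fromℕ F (d ∸ j) * sumAll (topTerm η)              ≈⟨ *-congʳ coefficient ⟩
    fromℕ F (suc (suc j)) * B ⁻¹ * sumAll (topTerm η)         ≈⟨ *-assoc _ _ _ ⟩
    fromℕ F (suc (suc j)) * w η                              ∎
    where
    B B₊ : Carrier
    B  = fromℕ F (suc d C ∣ η ∣)
    B₊ = fromℕ F (suc d C suc (suc j))

    coefficient : B₊ ⁻¹ * fromℕ F (d ∸ j) ≈ fromℕ F (suc (suc j)) * B ⁻¹
    coefficient = ⁻¹-*-transpose (fromℕ-≢0 (nCk≢0 (s≤s j<d))) (fromℕ-≢0 (nCk≢0 (P.subst (_≤ suc d) (P.sym ∣η∣≡j+1) (m≤n⇒m≤1+n j<d)))) (begin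
      fromℕ F (d ∸ j) * B                          ≈⟨ fromℕ-* (d ∸ j) (suc d C ∣ η ∣) ⟨
      fromℕ F ((d ∸ j) *ℕ (suc d C ∣ η ∣))          ≡⟨ P.cong (λ m → fromℕ F ((d ∸ j) *ℕ (suc d C m))) ∣η∣≡j+1 ⟩
      fromℕ F ((d ∸ j) *ℕ (suc d C suc j))          ≡⟨ P.cong (fromℕ F) ([n∸k]*nCk≡[k+1]*nC[k+1] (suc d) (suc j)) ⟩
      fromℕ F (suc (suc j) *ℕ (suc d C suc (suc j))) ≈⟨ fromℕ-* (suc (suc j)) (suc d C suc (suc j)) ⟩
      fromℕ F (suc (suc j)) * B₊                    ∎)

    T : Subset n → Subset n → Carrier
    T v ρ = guard (extendsᵇ η v) (topTerm (η ∪ v) ρ)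

    expand : ∀ v → guard (extendsᵇ η v) (w (η ∪ v)) ≈ B₊ ⁻¹ * sumAll (T v)
    expand v = begin
      guard (extendsᵇ η v) (w (η ∪ v))                            ≈⟨ guard-congʳ (extendsᵇ η v) (λ ext → *-congʳ (reflexive (P.cong (λ m → fromℕ F (suc d C m) ⁻¹) (size ext)))) ⟩
      guard (extendsᵇ η v) (B₊ ⁻¹ * sumAll (topTerm (η ∪ v)))     ≈⟨ guard-*ˡ (extendsᵇ η v) _ _ ⟩
      B₊ ⁻¹ * guard (extendsᵇ η v) (sumAll (topTerm (η ∪ v)))     ≈⟨ *-congˡ (guard-sumAll (extendsᵇ η v) (topTerm (η ∪ v))) ⟩
      B₊ ⁻¹ * sumAll (T v)                                      ∎
      where
      size : extendsᵇ η v ≡ true → ∣ η ∪ v ∣ ≡ suc (suc j)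
      size ext = let ∣v∣≡1 , rest = ∧-true⁻ (∣ v ∣ ≡ᵇ 1) ext in
        P.trans (∣p∪q∣≡∣p∣+∣q∣ η v (proj₁ (∧-true⁻ (disjointᵇ η v) rest)))
                (P.trans (P.cong₂ _+ℕ_ ∣η∣≡j+1 (≡ᵇ-true⇒≡ ∣v∣≡1)) (ℕ-+-comm (suc j) 1))

module VertexLinks {c ℓ : Level} (F : OrderedField c ℓ) {n : ℕ} (X : Complex n) (d : ℕ)
                   (wtop : Subset n → OrderedField.Carrier F) (closed : IsDownwardClosed X) (k : ℕ)
                   (f : Subset n → OrderedField.Carrier F) where
  open OrderedField F
  open FieldProperties F
  open Sums F
  open SubsetProperties
  open Binomial using (nCk≢0)
  open InducedWeights F X d wtop
  open WalkQuadraticForm F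
  open SetoidReasoning setoid
  open import Data.Fin.Subset.Properties using (p⊆p∪q; q⊆p∪q)
  open import Data.Bool.Properties using (⇔→≡)
  open import Function.Bundles using (mk⇔)
  open import Data.Nat.Properties using (m≤m+n)
  open import Data.Nat.Combinatorics using (nC1≡n)
  open CommutativeMonoidSolver *-commutativeMonoid using (solve; _⊕_; _⊜_)

  link-face⇒face : ∀ {j} v ρ → inDim (link X v) j ρ ≡ true → inDim X j ρ ≡ true
  link-face⇒face v ρ h = let ρ∈link , size = ∧-true⁻ (link X v ρ) h in
    P.cong₂ _∧_ (closed (ρ ∪ v) ρ (p⊆p∪q v) (proj₁ (∧-true⁻ (X (ρ ∪ v)) ρ∈link))) size

  face⇒link-face : ∀ {j} v ρ → X (ρ ∪ v) ≡ true → disjointᵇ ρ v ≡ true → inDim X j ρ ≡ true → inDim (link X v) j ρ ≡ true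
  face⇒link-face v ρ ρ∪v∈X ρ#v h = P.cong₂ _∧_ (P.cong₂ _∧_ ρ∪v∈X ρ#v) (proj₂ (∧-true⁻ (X ρ) h))

  adjacent-in-link : ∀ v σ τ → (inDim X 0 v ∧ adjacentᵇ (link X v) k σ τ) ≡ (adjacentᵇ X k σ τ ∧ extendsᵇ (σ ∪ τ) v)
  adjacent-in-link v σ τ = ⇔→≡ (mk⇔ to from)
    where
    η = σ ∪ τ
    to : (inDim X 0 v ∧ adjacentᵇ (link X v) k σ τ) ≡ true → (adjacentᵇ X k σ τ ∧ extendsᵇ η v) ≡ true
    to h =
      let v∈X0 , adjacentInLink = ∧-true⁻ (inDim X 0 v) h
          σ∈Lk , rest           = ∧-true⁻ (inDim (link X v) k σ) adjacentInLink
          τ∈Lk , η∈Lk           = ∧-true⁻ (inDim (link X v) k τ) rest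
          η∈link , _            = ∧-true⁻ (link X v η) η∈Lk
          η∪v∈X , η#v           = ∧-true⁻ (X (η ∪ v)) η∈link
      in P.cong₂ _∧_ (P.cong₂ _∧_ (link-face⇒face v σ σ∈Lk) (P.cong₂ _∧_ (link-face⇒face v τ τ∈Lk) (link-face⇒face v η η∈Lk)))
                     (P.cong₂ _∧_ (proj₂ (∧-true⁻ (X v) v∈X0)) (P.cong₂ _∧_ η#v η∪v∈X))
    from : (adjacentᵇ X k σ τ ∧ extendsᵇ η v) ≡ true → (inDim X 0 v ∧ adjacentᵇ (link X v) k σ τ) ≡ true
    from h =
      let adjacent , extends = ∧-true⁻ (adjacentᵇ X k σ τ) h
          σ∈Xk , rest        = ∧-true⁻ (inDim X k σ) adjacent
          τ∈Xk , η∈Xk        = ∧-true⁻ (inDim X k τ) rest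
          ∣v∣≡1 , rest′       = ∧-true⁻ (∣ v ∣ ≡ᵇ 1) extends
          η#v , η∪v∈X        = ∧-true⁻ (disjointᵇ η v) rest′
          σ#v , τ#v          = ∧-true⁻ (disjointᵇ σ v) (P.trans (P.sym (disjointᵇ-∪ˡ σ τ v)) η#v)
          face∪v : ∀ ρ → ρ ⊆ η → X (ρ ∪ v) ≡ true
          face∪v ρ ρ⊆η = closed (η ∪ v) (ρ ∪ v) (∪-monoˡ-⊆ v ρ⊆η) η∪v∈X
      in P.cong₂ _∧_ (P.cong₂ _∧_ (closed (η ∪ v) v (q⊆p∪q η v) η∪v∈X) ∣v∣≡1)
                     (P.cong₂ _∧_ (face⇒link-face v σ (face∪v σ (p⊆p∪q τ)) σ#v σ∈Xk)
                       (P.cong₂ _∧_ (face⇒link-face v τ (face∪v τ (q⊆p∪q σ τ)) τ#v τ∈Xk)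
                                    (face⇒link-face v η η∪v∈X η#v η∈Xk)))

  [k+3] : Carrier
  [k+3] = fromℕ F (suc (suc (suc k)))

  extensionTerm : Subset n → Subset n → Subset n → Carrier
  extensionTerm v σ τ = w ((σ ∪ τ) ∪ v) * (f σ * f τ)

  linkForm : Subset n → Carrier
  linkForm v = sumAll² (λ σ τ → guard (inDim X 0 v ∧ adjacentᵇ (link X v) k σ τ) (extensionTerm v σ τ))

  vertex-inner-walk : (∀ τ → X τ ≡ true → w τ ≉ 0#) → ∀ v →
    guard (inDim X 0 v) (w v * inner F (link X v) (linkW F w v) k (walk F (link X v) (linkW F w v) k f) f)
      ≈ walkScale k * ([k+3] ⁻¹ * linkForm v)
  vertex-inner-walk w≉0 v = begin
    guard (inDim X 0 v) (w v * inner F L wL k (walk F L wL k f) f)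
      ≈⟨ guard-congʳ (inDim X 0 v) inLink ⟩
    guard (inDim X 0 v) (walkScale k * ([k+3] ⁻¹ * sumAll² (λ σ τ → guard (adjacentᵇ L k σ τ) (extensionTerm v σ τ))))
      ≈⟨ trans (guard-*ˡ (inDim X 0 v) _ _) (*-congˡ (guard-*ˡ (inDim X 0 v) _ _)) ⟩
    walkScale k * ([k+3] ⁻¹ * guard (inDim X 0 v) (sumAll² (λ σ τ → guard (adjacentᵇ L k σ τ) (extensionTerm v σ τ))))
      ≈⟨ *-congˡ (*-congˡ (guard-sumAll² (inDim X 0 v) (adjacentᵇ L k) (extensionTerm v))) ⟩
    walkScale k * ([k+3] ⁻¹ * linkForm v)
      ∎
    where
    L  = link X v
    wL = linkW F w v
    inLink : inDim X 0 v ≡ true →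
             w v * inner F L wL k (walk F L wL k f) f ≈ walkScale k * ([k+3] ⁻¹ * sumAll² (λ σ τ → guard (adjacentᵇ L k σ τ) (extensionTerm v σ τ)))
    inLink v∈X0 = begin
      w v * inner F L wL k (walk F L wL k f) f       ≈⟨ *-congˡ (inner-walk L wL k f wL≉0) ⟩
      w v * (walkScale k * edgeForm L wL k f)        ≈⟨ solve 3 (λ a b x → a ⊕ (b ⊕ x) ⊜ b ⊕ (a ⊕ x)) refl (w v) (walkScale k) _ ⟩
      walkScale k * (w v * edgeForm L wL k f)        ≈⟨ *-congˡ (sumAll²-*ˡ (w v) (λ σ τ → guard (adjacentᵇ L k σ τ) (wL (σ ∪ τ) * (f σ * f τ)))) ⟨
      walkScale k * sumAll² (λ σ τ → w v * guard (adjacentᵇ L k σ τ) (wL (σ ∪ τ) * (f σ * f τ)))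
                                                     ≈⟨ *-congˡ (sumAll²-cong rescale) ⟩
      walkScale k * sumAll² (λ σ τ → [k+3] ⁻¹ * guard (adjacentᵇ L k σ τ) (extensionTerm v σ τ))
                                                     ≈⟨ *-congˡ (sumAll²-*ˡ ([k+3] ⁻¹) (λ σ τ → guard (adjacentᵇ L k σ τ) (extensionTerm v σ τ))) ⟩
      walkScale k * ([k+3] ⁻¹ * sumAll² (λ σ τ → guard (adjacentᵇ L k σ τ) (extensionTerm v σ τ)))  ∎
      where
      v∈X : X v ≡ true
      v∈X = proj₁ (∧-true⁻ (X v) v∈X0)
      wL≉0 : ∀ σ → inDim L k σ ≡ true → wL σ ≉ 0#
      wL≉0 σ σ∈Lk = *-≉0 (w≉0 (σ ∪ v) (proj₁ (∧-true⁻ (X (σ ∪ v)) (proj₁ (∧-true⁻ (L σ) σ∈Lk)))))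
                         (⁻¹-≉0 (*-≉0 (fromℕ-≢0 (nCk≢0 (m≤m+n ∣ v ∣ ∣ σ ∣))) (w≉0 v v∈X)))
      rescale : ∀ σ τ → w v * guard (adjacentᵇ L k σ τ) (wL (σ ∪ τ) * (f σ * f τ))
                        ≈ [k+3] ⁻¹ * guard (adjacentᵇ L k σ τ) (extensionTerm v σ τ)
      rescale σ τ = trans (sym (guard-*ˡ (adjacentᵇ L k σ τ) _ _))
                   (trans (guard-congʳ (adjacentᵇ L k σ τ) edge) (guard-*ˡ (adjacentᵇ L k σ τ) _ _))
        where
        η = σ ∪ τ
        edge : adjacentᵇ L k σ τ ≡ true → w v * (wL η * (f σ * f τ)) ≈ [k+3] ⁻¹ * extensionTerm v σ τ
        edge adjacent = begin
          w v * (wL η * (f σ * f τ))                   ≈⟨ *-assoc _ _ _ ⟨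
          w v * wL η * (f σ * f τ)                     ≈⟨ *-congʳ (*-linkW w v η (w≉0 v v∈X)) ⟩
          fromℕ F ((∣ v ∣ +ℕ ∣ η ∣) C ∣ v ∣) ⁻¹ * w (η ∪ v) * (f σ * f τ)  ≈⟨ *-assoc _ _ _ ⟩
          fromℕ F ((∣ v ∣ +ℕ ∣ η ∣) C ∣ v ∣) ⁻¹ * extensionTerm v σ τ      ≡⟨ P.cong (λ m → fromℕ F m ⁻¹ * extensionTerm v σ τ) binomial ⟩
          [k+3] ⁻¹ * extensionTerm v σ τ               ∎
          where
          ∣v∣≡1 : ∣ v ∣ ≡ 1
          ∣v∣≡1 = ≡ᵇ-true⇒≡ (proj₂ (∧-true⁻ (X v) v∈X0))
          ∣η∣≡k+2 : ∣ η ∣ ≡ suc (suc k)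
          ∣η∣≡k+2 = ≡ᵇ-true⇒≡ (proj₂ (∧-true⁻ (L η) (proj₂ (∧-true⁻ (inDim L k τ) (proj₂ (∧-true⁻ (inDim L k σ) adjacent))))))
          binomial : (∣ v ∣ +ℕ ∣ η ∣) C ∣ v ∣ ≡ suc (suc (suc k))
          binomial = P.trans (P.cong₂ (λ a b → (a +ℕ b) C a) ∣v∣≡1 ∣η∣≡k+2) (nC1≡n (suc (suc (suc k))))

  sum-vertexExtensions : suc (suc k) ≤ d → ∀ σ τ →
    sumAll (λ v → guard (adjacentᵇ X k σ τ ∧ extendsᵇ (σ ∪ τ) v) (extensionTerm v σ τ))
      ≈ [k+3] * guard (adjacentᵇ X k σ τ) (w (σ ∪ τ) * (f σ * f τ))
  sum-vertexExtensions k+2≤d σ τ = begin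
    sumAll (λ v → guard (adjacent ∧ extendsᵇ η v) (extensionTerm v σ τ))     ≈⟨ sumAll-cong (λ v → reflexive (guard-∧ adjacent (extendsᵇ η v) _)) ⟩
    sumAll (λ v → guard adjacent (guard (extendsᵇ η v) (extensionTerm v σ τ)))  ≈⟨ guard-sumAll adjacent (λ v → guard (extendsᵇ η v) (extensionTerm v σ τ)) ⟨
    guard adjacent (sumAll (λ v → guard (extendsᵇ η v) (extensionTerm v σ τ)))  ≈⟨ guard-congʳ adjacent extensions ⟩
    guard adjacent ([k+3] * (w η * (f σ * f τ)))                              ≈⟨ guard-*ˡ adjacent _ _ ⟩
    [k+3] * guard adjacent (w η * (f σ * f τ))                                ∎
    where
    η = σ ∪ τ
    adjacent = adjacentᵇ X k σ τ
    extensions : adjacent ≡ true → sumAll (λ v → guard (extendsᵇ η v) (extensionTerm v σ τ)) ≈ [k+3] * (w η * (f σ * f τ))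
    extensions σ∼τ = begin
      sumAll (λ v → guard (extendsᵇ η v) (w (η ∪ v) * (f σ * f τ)))   ≈⟨ sumAll-cong (λ v → guard-*ʳ (extendsᵇ η v) _ _) ⟩
      sumAll (λ v → guard (extendsᵇ η v) (w (η ∪ v)) * (f σ * f τ))   ≈⟨ sumList-*ʳ (allSubsets n) _ _ ⟩
      sumAll (λ v → guard (extendsᵇ η v) (w (η ∪ v))) * (f σ * f τ)   ≈⟨ *-congʳ (sum-extensions closed k+2≤d η ∣η∣≡k+2) ⟩
      [k+3] * w η * (f σ * f τ)                                       ≈⟨ *-assoc _ _ _ ⟩
      [k+3] * (w η * (f σ * f τ))                                     ∎
      where
      ∣η∣≡k+2 : ∣ η ∣ ≡ suc (suc k)
      ∣η∣≡k+2 = ≡ᵇ-true⇒≡ (proj₂ (∧-true⁻ (X η) (proj₂ (∧-true⁻ (inDim X k τ) (proj₂ (∧-true⁻ (inDim X k σ) σ∼τ))))))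

  inner-walk≈sum-links : (∀ τ → X τ ≡ true → w τ ≉ 0#) → suc (suc k) ≤ d →
    inner F X w k (walk F X w k f) f
      ≈ sumDim F X 0 (λ v → w v * inner F (link X v) (linkW F w v) k (walk F (link X v) (linkW F w v) k f) f)
  inner-walk≈sum-links w≉0 k+2≤d = begin
    inner F X w k (walk F X w k f) f
      ≈⟨ inner-walk X w k f (λ σ σ∈Xk → w≉0 σ (proj₁ (∧-true⁻ (X σ) σ∈Xk))) ⟩
    walkScale k * edgeForm X w k f
      ≈⟨ *-congˡ (⁻¹-cancelʳ _ (fromℕ-≢0 {suc (suc (suc k))} λ ())) ⟨
    walkScale k * ([k+3] ⁻¹ * ([k+3] * edgeForm X w k f))
      ≈⟨ *-congˡ (*-congˡ (sumAll²-*ˡ [k+3] edge)) ⟨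
    walkScale k * ([k+3] ⁻¹ * sumAll² (λ σ τ → [k+3] * edge σ τ))
      ≈⟨ *-congˡ (*-congˡ (sumAll²-cong λ σ τ → sym (sum-vertexExtensions k+2≤d σ τ))) ⟩
    walkScale k * ([k+3] ⁻¹ * sumAll² (λ σ τ → sumAll (λ v → guard (adjacentᵇ X k σ τ ∧ extendsᵇ (σ ∪ τ) v) (extensionTerm v σ τ))))
      ≈⟨ *-congˡ (*-congˡ (sumAll²-cong λ σ τ → sumAll-cong λ v → reflexive (P.cong (λ b → guard b (extensionTerm v σ τ)) (adjacent-in-link v σ τ)))) ⟨
    walkScale k * ([k+3] ⁻¹ * sumAll² (λ σ τ → sumAll (λ v → T v σ τ)))
      ≈⟨ *-congˡ (*-congˡ (trans (sumAll-cong λ σ → sumAll-comm (λ τ v → T v σ τ)) (sumAll-comm (λ σ v → sumAll (T v σ))))) ⟩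
    walkScale k * ([k+3] ⁻¹ * sumAll linkForm)
      ≈⟨ trans (sumAll-*ˡ (walkScale k) (λ v → [k+3] ⁻¹ * linkForm v)) (*-congˡ (sumAll-*ˡ ([k+3] ⁻¹) linkForm)) ⟨
    sumAll (λ v → walkScale k * ([k+3] ⁻¹ * linkForm v))
      ≈⟨ sumAll-cong (λ v → vertex-inner-walk w≉0 v) ⟨
    sumDim F X 0 (λ v → w v * inner F (link X v) (linkW F w v) k (walk F (link X v) (linkW F w v) k f) f)
      ∎
    where
    edge : Subset n → Subset n → Carrier
    edge σ τ = guard (adjacentᵇ X k σ τ) (w (σ ∪ τ) * (f σ * f τ))
    T : Subset n → Subset n → Subset n → Carrier
    T v σ τ = guard (inDim X 0 v ∧ adjacentᵇ (link X v) k σ τ) (extensionTerm v σ τ)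

mainTheorem8 : {c ℓ : Level} (F : OrderedField c ℓ) →
    let open OrderedField F in
    (n d k : ℕ) (X : Complex n) → IsPureComplex X d →
    (wtop : Subset n → Carrier) →
    (∀ (σ : Subset n) → X σ ≡ true → ∣ σ ∣ ≡ suc d → 0# < wtop σ) →
    sumDim F X d wtop ≈ 1# →
    k +ℕ 2 ≤ d →
    (f : Subset n → Carrier) →
    let w = inducedW F X d wtop in
    inner F X w k (walk F X w k f) f
      ≈ sumDim F X 0 (λ v → w v * inner F (link X v) (linkW F w v) k
                                 (walk F (link X v) (linkW F w v) k f) f)
mainTheorem8 F n d k X pure wtop wtop>0 _ k+2≤d f =
  VertexLinks.inner-walk≈sum-links F X d wtop (proj₁ pure) k f
    (InducedWeights.inducedW-≉0 F X d wtop pure wtop>0)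
    (P.subst (_≤ d) (+-comm k 2) k+2≤d)
  where open import Data.Nat.Properties using (+-comm)
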